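{- Let $a,b,c,d$ be four distinct letters and let $f_{\infty,\infty}$ be the infinite two-dimensional Fibonacci word defined in the context. For $k,l\ge1$, let $p_{k,l}(f_{\infty,\infty})$ denote the number of distinct subarrays of $f_{\infty,\infty}$ of size $(k,l)$ (i.e. with $k$ rows and $l$ columns). Then $p_{k,l}(f_{\infty,\infty})=(k+1)(l+1)$.
   Context: For arrays $u,v$ with equal numbers of rows, $u\circ_c v$ places $v$ to the right of $u$; with equal numbers of columns, $u\circ_r v$ places $v$ below $u$. Let $\mu$ be defined on letters by $\mu(d)=\begin{smallmatrix} d & c\\ b & a\end{smallmatrix}$, $\mu(c)=\begin{smallmatrix} d\\ b\end{smallmatrix}$ ($2\times1$), $\mu(b)=\begin{smallmatrix} d & c\end{smallmatrix}$ ($1\times2$), $\mu(a)=d$, and on arrays $x=[x_{i,j}]$ of size $(p,q)$ (when compatible: for each $i$ all $\mu(x_{i,j})$ have the same number of rows, for each $j$ the same number of columns) by $\mu(x)=R_1\circ_r\cdots\circ_r R_p$, $R_i=\mu(x_{i,1})\circ_c\cdots\circ_c\mu(x_{i,q})$. The infinite array $f_{\infty,\infty}:\mathbb{N}\times\mathbb{N}\to\{a,b,c,d\}$ is the limit of the iterates $\mu^n(d)$, each of which is a top-left prefix of $f_{\infty,\infty}$. (Equivalently, $f_{\infty,\infty}$ is the limit of the finite Fibonacci arrays $f_{n,n}$ defined by $f_{0,0}=a$, $f_{0,1}=b$, $f_{1,0}=c$, $f_{1,1}=d$, $f_{k,n+1}=f_{k,n}\circ_c f_{k,n-1}$, $f_{m+1,k}=f_{m,k}\circ_r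 f_{m-1,k}$.) -}

module Defs where

open import Data.Nat using (ℕ; zero; suc; _+_; _<ᵇ_)
open import Data.Nat.Properties using ()
open import Data.Bool using (if_then_else_)
open import Data.Fin using (Fin; toℕ)
open import Data.Vec using (Vec; tabulate)
open import Data.List using (List; length)
open import Data.List.Relation.Unary.All using (All)
open import Data.List.Relation.Unary.Unique.Propositional using (Unique)
open import Data.List.Membership.Propositional using (_∈_)
open import Data.Product using (Σ; ∃; _×_; _,_)
open import Relation.Binary.PropositionalEquality using (_≡_)

data Letter : Set where
  a b c d : Letter

-- A finite array: number of rows, number of columns, and the entries
-- (given as a total function; only entries (i , j) with i < rows, j < cols matter).
record Array : Set where
  constructor mkArray
  field
    rows : ℕ
    cols : ℕ
    entry : ℕ → ℕ → Letter
open Array public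

_∘c_ : Array → Array → Array
u ∘c v = mkArray (rows u) (cols u + cols v)
  (λ i j → if j <ᵇ cols u then entry u i j else entry v i (j Data.Nat.∸ cols u))

_∘r_ : Array → Array → Array
u ∘r v = mkArray (rows u + rows v) (cols u)
  (λ i j → if i <ᵇ rows u then entry u i j else entry v (i Data.Nat.∸ rows u) j)

single : Letter → Array
single x = mkArray 1 1 (λ _ _ → x)

fibRow : Letter → Letter → ℕ → Array
fibRow x y zero = single x
fibRow x y (suc zero) = single y
fibRow x y (suc (suc n)) = fibRow x y (suc n) ∘c fibRow x y n

fib2 : ℕ → ℕ → Array
fib2 zero n = fibRow a b n
fib2 (suc zero) n = fibRow c d n
fib2 (suc (suc m)) n = fib2 (suc m) n ∘r fib2 m n

-- The infinite Fibonacci array f_{∞,∞}: the entry (i , j) is read off from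
-- f_{N,N} with N = 1 + i + j, which has at least N rows and N columns
-- (the f_{n,n} are top-left prefixes of each other, so this is the limit).
fInf : ℕ → ℕ → Letter
fInf i j = entry (fib2 (suc (i + j)) (suc (i + j))) i j

block : (k l : ℕ) → ℕ → ℕ → Vec (Vec Letter l) k
block k l i j = tabulate (λ x → tabulate (λ y → fInf (i + toℕ x) (j + toℕ y)))

-- p_{k,l}(f_{∞,∞}) = N : the set of subarrays of size (k , l) of f_{∞,∞}
-- has exactly N elements, i.e. it is enumerated by a duplicate-free list of length N.
ComplexityIs : (k l N : ℕ) → Set
ComplexityIs k l N =
  Σ (List (Vec (Vec Letter l) k)) λ L →
    (length L ≡ N) × Unique L
    × (∀ i j → block k l i j ∈ L)
    × All (λ B → ∃ λ i → ∃ λ j → block k l i j ≡ B) L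

{-# OPTIONS --safe #-}
-- f∞,∞ is the product of two copies of the Fibonacci word w = fib∞ (over Bool, the fixed
-- point of σ true = true false, σ false = true): fibRow and fib2 obey the same concatenation
-- rule horizontally and vertically, so f∞,∞(i, j) is the letter determined by (w i, w j).
-- A (k, l)-block is thus the same as a pair of factors of w of lengths k and l, and
-- p_{k,l} = p(k) p(l) for the factor complexity p of w. Finally w is Sturmian, p(n) = n + 1:
-- p(0) = 1 and p(n + 1) = p(n) + 1, since w has exactly one right special factor of each
-- length. One exists because fibWord (n + 1) ++ fibWord n and fibWord n ++ fibWord (n + 1)
-- differ only in their last two letters; there is at most one because w is balanced (if x u x
-- and y u y both occur then x = y), which follows by strong induction on the length of u,
-- desubstituting both occurrences along w = σ w.
module Submission where

open import Defs
open import Data.Bool using (Bool; true; false; not; if_then_else_)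
open import Data.Bool.Properties using (not-injective; not-¬; ¬-not) renaming (_≟_ to _≟ᵇ_)
open import Data.Empty using (⊥-elim)
open import Data.Fin using (zero; toℕ; fromℕ<)
open import Data.Fin.Properties using (toℕ<n; toℕ-fromℕ<)
open import Data.List using (List; []; _∷_; _++_; length; map; cartesianProductWith)
open import Data.List.Properties using (length-++; length-map; ++-assoc; ++-identityʳ)
open import Data.List.Membership.Propositional using (_∈_)
open import Data.List.Membership.Propositional.Properties
  using (∈-++⁺ˡ; ∈-++⁺ʳ; ∈-map⁺; ∈-cartesianProductWith⁺; ∈-cartesianProductWith⁻)
open import Data.List.Relation.Unary.All as All using (All; []; _∷_)
import Data.List.Relation.Unary.All.Properties as All
open import Data.List.Relation.Unary.AllPairs as AllPairs using (AllPairs; []; _∷_)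
import Data.List.Relation.Unary.AllPairs.Properties as AllPairs
open import Data.List.Relation.Unary.Any using (here; there)
open import Data.List.Relation.Unary.Unique.Propositional using (Unique)
open import Data.List.Relation.Unary.Unique.Propositional.Properties using (cartesianProductWith⁺)
open import Data.Nat
  using (ℕ; zero; suc; _+_; _*_; _∸_; _≤_; _<_; _≥_; _<ᵇ_; _≤′_; z≤n; s≤s; ≤′-refl; ≤′-step)
open import Data.Nat.Induction using (<-rec)
open import Data.Nat.Properties
open import Data.Product using (Σ; ∃; ∃₂; _×_; _,_; proj₁; proj₂)
import Data.Product as Product
open import Data.Sum using (_⊎_; inj₁; inj₂)
open import Data.Vec using (Vec; tabulate; lookup)
open import Data.Vec.Properties using (tabulate-cong; lookup∘tabulate; tabulate∘lookup)
open import Function using (case_of_)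
open import Relation.Binary.PropositionalEquality
open import Relation.Nullary using (¬_; yes; no; contradiction)
open import Relation.Nullary.Reflects using (ofʸ; ofⁿ)

-- Out of range `at` returns false; it is only used in range.
at : List Bool → ℕ → Bool
at []       _       = false
at (x ∷ xs) zero    = x
at (x ∷ xs) (suc i) = at xs i

at-++ˡ : ∀ xs ys {i} → i < length xs → at (xs ++ ys) i ≡ at xs i
at-++ˡ (x ∷ xs) ys {zero}  _         = refl
at-++ˡ (x ∷ xs) ys {suc i} (s≤s i<n) = at-++ˡ xs ys i<n

at-++ʳ : ∀ xs ys i → at (xs ++ ys) (length xs + i) ≡ at ys i
at-++ʳ []       ys i = refl
at-++ʳ (x ∷ xs) ys i = at-++ʳ xs ys i

at-++-glue : ∀ {A : Set} (h : Bool → A) xs ys {L} {u v : ℕ → A} → L ≡ length xs →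
  (∀ {i} → i < length xs → u i ≡ h (at xs i)) →
  (∀ {i} → i < length ys → v i ≡ h (at ys i)) →
  ∀ {i} → i < length xs + length ys →
  (if i <ᵇ L then u i else v (i ∸ L)) ≡ h (at (xs ++ ys) i)
at-++-glue h xs ys refl hu hv {i} i< with i <ᵇ length xs | <ᵇ-reflects-< i (length xs)
... | true  | ofʸ i<xs = trans (hu i<xs) (cong h (sym (at-++ˡ xs ys i<xs)))
... | false | ofⁿ i≮xs = trans (hv (+-cancelˡ-< (length xs) _ _ (subst (_< _) (sym i≡) i<))) (cong h (begin
    at ys (i ∸ length xs)                            ≡⟨ at-++ʳ xs ys (i ∸ length xs) ⟨
    at (xs ++ ys) (length xs + (i ∸ length xs))      ≡⟨ cong (at (xs ++ ys)) i≡ ⟩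
    at (xs ++ ys) i                                  ∎))
  where
  open ≡-Reasoning
  i≡ : length xs + (i ∸ length xs) ≡ i
  i≡ = m+[n∸m]≡n (≮⇒≥ i≮xs)

fibWord : ℕ → List Bool
fibWord zero          = false ∷ []
fibWord (suc zero)    = true ∷ []
fibWord (suc (suc n)) = fibWord (suc n) ++ fibWord n

letter : Bool → Bool → Letter
letter false false = a
letter false true  = b
letter true  false = c
letter true  true  = d

rowBit colBit : Letter → Bool
rowBit a = false
rowBit b = false
rowBit c = true
rowBit d = true
colBit a = false
colBit b = true
colBit c = false
colBit d = true

rowBit-letter : ∀ r s → rowBit (letter r s) ≡ r
rowBit-letter false false = refl
rowBit-letter false true  = refl
rowBit-letter true  false = refl
rowBit-letter true  true  = refl

colBit-letter : ∀ r s → colBit (letter r s) ≡ s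
colBit-letter false false = refl
colBit-letter false true  = refl
colBit-letter true  false = refl
colBit-letter true  true  = refl

letter-injective : ∀ {r s r′ s′} → letter r s ≡ letter r′ s′ → r ≡ r′ × s ≡ s′
letter-injective {r} {s} {r′} {s′} eq =
  trans (sym (rowBit-letter r s)) (trans (cong rowBit eq) (rowBit-letter r′ s′)) ,
  trans (sym (colBit-letter r s)) (trans (cong colBit eq) (colBit-letter r′ s′))

cols-fibRow : ∀ x y n → cols (fibRow x y n) ≡ length (fibWord n)
cols-fibRow x y zero          = refl
cols-fibRow x y (suc zero)    = refl
cols-fibRow x y (suc (suc n)) =
  trans (cong₂ _+_ (cols-fibRow x y (suc n)) (cols-fibRow x y n)) (sym (length-++ (fibWord (suc n))))

rows-fibRow : ∀ x y n → rows (fibRow x y n) ≡ 1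
rows-fibRow x y zero          = refl
rows-fibRow x y (suc zero)    = refl
rows-fibRow x y (suc (suc n)) = rows-fibRow x y (suc n)

rows-fib2 : ∀ m n → rows (fib2 m n) ≡ length (fibWord m)
rows-fib2 zero          n = rows-fibRow a b n
rows-fib2 (suc zero)    n = rows-fibRow c d n
rows-fib2 (suc (suc m)) n =
  trans (cong₂ _+_ (rows-fib2 (suc m) n) (rows-fib2 m n)) (sym (length-++ (fibWord (suc m))))

entry-fibRow : ∀ r n {i j} → j < length (fibWord n) →
  entry (fibRow (letter r false) (letter r true) n) i j ≡ letter r (at (fibWord n) j)
entry-fibRow r zero          (s≤s z≤n) = refl
entry-fibRow r (suc zero)    (s≤s z≤n) = refl
entry-fibRow r (suc (suc n)) {i} j< =
  at-++-glue (letter r) (fibWord (suc n)) (fibWord n) (cols-fibRow _ _ (suc n))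
    (entry-fibRow r (suc n) {i}) (entry-fibRow r n {i}) (subst (_ <_) (length-++ (fibWord (suc n))) j<)

entry-fib2 : ∀ m n {i j} → i < length (fibWord m) → j < length (fibWord n) →
  entry (fib2 m n) i j ≡ letter (at (fibWord m) i) (at (fibWord n) j)
entry-fib2 zero          n (s≤s z≤n) j< = entry-fibRow false n j<
entry-fib2 (suc zero)    n (s≤s z≤n) j< = entry-fibRow true n j<
entry-fib2 (suc (suc m)) n {j = j} i< j< =
  at-++-glue (λ r → letter r (at (fibWord n) j)) (fibWord (suc m)) (fibWord m) (rows-fib2 (suc m) n)
    (λ i<′ → entry-fib2 (suc m) n i<′ j<) (λ i<′ → entry-fib2 m n i<′ j<)
    (subst (_ <_) (length-++ (fibWord (suc m))) i<)

1≤length-fibWord : ∀ n → 1 ≤ length (fibWord n)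
1≤length-fibWord zero          = ≤-refl
1≤length-fibWord (suc zero)    = ≤-refl
1≤length-fibWord (suc (suc n)) =
  subst (1 ≤_) (sym (length-++ (fibWord (suc n)))) (≤-trans (1≤length-fibWord (suc n)) (m≤m+n _ _))

n<length-fibWord : ∀ n → n < length (fibWord (suc n))
n<length-fibWord zero    = ≤-refl
n<length-fibWord (suc n) = subst (suc n <_) (sym (length-++ (fibWord (suc n))))
  (subst (_≤ length (fibWord (suc n)) + length (fibWord n)) (+-comm (suc n) 1)
    (+-mono-≤ (n<length-fibWord n) (1≤length-fibWord n)))

fibWord-prefix : ∀ {m n} → m ≤′ n → ∃ λ ys → fibWord (suc n) ≡ fibWord (suc m) ++ ys
fibWord-prefix ≤′-refl = [] , sym (++-identityʳ _)
fibWord-prefix {m} (≤′-step {n} m≤n) with ys , eq ← fibWord-prefix m≤n =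
  ys ++ fibWord n , trans (cong (_++ fibWord n) eq) (++-assoc (fibWord (suc m)) ys (fibWord n))

at-fibWord-prefix : ∀ {m n i} → m ≤ n → i < length (fibWord (suc m)) →
  at (fibWord (suc n)) i ≡ at (fibWord (suc m)) i
at-fibWord-prefix {m} m≤n i< with ys , eq ← fibWord-prefix (≤⇒≤′ m≤n) =
  trans (cong (λ xs → at xs _) eq) (at-++ˡ (fibWord (suc m)) ys i<)

fib∞ : ℕ → Bool
fib∞ i = at (fibWord (suc i)) i

at-fibWord : ∀ m {i} → i < length (fibWord (suc m)) → at (fibWord (suc m)) i ≡ fib∞ i
at-fibWord m {i} i< with ≤-total m i
... | inj₁ m≤i = sym (at-fibWord-prefix m≤i i<)
... | inj₂ i≤m = at-fibWord-prefix i≤m (n<length-fibWord i)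

fInf-letter : ∀ i j → fInf i j ≡ letter (fib∞ i) (fib∞ j)
fInf-letter i j = trans (entry-fib2 N N i<N j<N) (cong₂ letter (at-fibWord (i + j) i<N) (at-fibWord (i + j) j<N))
  where
  N : ℕ
  N = suc (i + j)
  i<N : i < length (fibWord N)
  i<N = ≤-<-trans (m≤m+n i j) (n<length-fibWord (i + j))
  j<N : j < length (fibWord N)
  j<N = ≤-<-trans (m≤n+m j i) (n<length-fibWord (i + j))

σ : List Bool → List Bool
σ []           = []
σ (true ∷ xs)  = true ∷ false ∷ σ xs
σ (false ∷ xs) = true ∷ σ xs

σ-++ : ∀ xs ys → σ (xs ++ ys) ≡ σ xs ++ σ ys
σ-++ []           ys = refl
σ-++ (true ∷ xs)  ys = cong (λ zs → true ∷ false ∷ zs) (σ-++ xs ys)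
σ-++ (false ∷ xs) ys = cong (true ∷_) (σ-++ xs ys)

fibWord-σ : ∀ n → fibWord (suc n) ≡ σ (fibWord n)
fibWord-σ zero          = refl
fibWord-σ (suc zero)    = refl
fibWord-σ (suc (suc n)) =
  trans (cong₂ _++_ (fibWord-σ (suc n)) (fibWord-σ n)) (sym (σ-++ (fibWord (suc n)) (fibWord n)))

∣σ∣ : Bool → ℕ
∣σ∣ true  = 2
∣σ∣ false = 1

1≤∣σ∣ : ∀ x → 1 ≤ ∣σ∣ x
1≤∣σ∣ true  = s≤s z≤n
1≤∣σ∣ false = s≤s z≤n

σ-imagePos : List Bool → ℕ → ℕ
σ-imagePos _        zero    = 0
σ-imagePos []       (suc k) = 0
σ-imagePos (x ∷ xs) (suc k) = ∣σ∣ x + σ-imagePos xs k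

σ-imagePos-suc : ∀ xs {k} → k < length xs → σ-imagePos xs (suc k) ≡ σ-imagePos xs k + ∣σ∣ (at xs k)
σ-imagePos-suc (x ∷ xs) {zero}  _         = +-identityʳ (∣σ∣ x)
σ-imagePos-suc (x ∷ xs) {suc k} (s≤s k<n) =
  trans (cong (∣σ∣ x +_) (σ-imagePos-suc xs k<n)) (sym (+-assoc (∣σ∣ x) _ _))

at-σ-imagePos : ∀ xs {k} → k < length xs → at (σ xs) (σ-imagePos xs k) ≡ true
at-σ-imagePos (true ∷ xs)  {zero}  _         = refl
at-σ-imagePos (false ∷ xs) {zero}  _         = refl
at-σ-imagePos (true ∷ xs)  {suc k} (s≤s k<n) = at-σ-imagePos xs k<n
at-σ-imagePos (false ∷ xs) {suc k} (s≤s k<n) = at-σ-imagePos xs k<n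

at-σ-imagePos-true : ∀ xs {k} → k < length xs → at xs k ≡ true →
  at (σ xs) (suc (σ-imagePos xs k)) ≡ false
at-σ-imagePos-true (true ∷ xs)  {zero}  _         _ = refl
at-σ-imagePos-true (true ∷ xs)  {suc k} (s≤s k<n) t = at-σ-imagePos-true xs k<n t
at-σ-imagePos-true (false ∷ xs) {suc k} (s≤s k<n) t = at-σ-imagePos-true xs k<n t

-- Since fib∞ = σ fib∞, imagePos k is where the image of fib∞ k begins inside fib∞.
imagePos : ℕ → ℕ
imagePos zero    = 0
imagePos (suc k) = imagePos k + ∣σ∣ (fib∞ k)

imagePos-suc : ∀ k → imagePos (suc k) ≡ ∣σ∣ (fib∞ k) + imagePos k
imagePos-suc k = +-comm (imagePos k) _

imagePos-suc-true : ∀ k → fib∞ k ≡ true → imagePos (suc k) ≡ suc (suc (imagePos k))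
imagePos-suc-true k wk = trans (imagePos-suc k) (cong (λ x → ∣σ∣ x + imagePos k) wk)

imagePos-suc-false : ∀ k → fib∞ k ≡ false → imagePos (suc k) ≡ suc (imagePos k)
imagePos-suc-false k wk = trans (imagePos-suc k) (cong (λ x → ∣σ∣ x + imagePos k) wk)

imagePos-<-suc : ∀ k → imagePos k < imagePos (suc k)
imagePos-<-suc k =
  subst (_≤ imagePos (suc k)) (+-comm (imagePos k) 1) (+-monoʳ-≤ (imagePos k) (1≤∣σ∣ (fib∞ k)))

imagePos-+ : ∀ k N → imagePos k + N ≤ imagePos (k + N)
imagePos-+ k zero    = ≤-reflexive (trans (+-identityʳ (imagePos k)) (cong imagePos (sym (+-identityʳ k))))
imagePos-+ k (suc N) = begin
  imagePos k + suc N         ≡⟨ +-suc (imagePos k) N ⟩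
  suc (imagePos k + N)       ≤⟨ s≤s (imagePos-+ k N) ⟩
  suc (imagePos (k + N))     ≤⟨ imagePos-<-suc (k + N) ⟩
  imagePos (suc (k + N))     ≡⟨ cong imagePos (+-suc k N) ⟨
  imagePos (k + suc N)       ∎
  where open ≤-Reasoning

imagePos-mono : ∀ {k k′} → k ≤ k′ → imagePos k ≤ imagePos k′
imagePos-mono {k} {k′} k≤k′ = begin
  imagePos k                ≤⟨ m≤m+n (imagePos k) (k′ ∸ k) ⟩
  imagePos k + (k′ ∸ k)     ≤⟨ imagePos-+ k (k′ ∸ k) ⟩
  imagePos (k + (k′ ∸ k))   ≡⟨ cong imagePos (m+[n∸m]≡n k≤k′) ⟩
  imagePos k′               ∎
  where open ≤-Reasoning

imagePos-cancel-≤ : ∀ {k k′} → imagePos k ≤ imagePos k′ → k ≤ k′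
imagePos-cancel-≤ {k} {k′} ik≤ik′ with k ≤? k′
... | yes k≤k′ = k≤k′
... | no  k≰k′ =
  contradiction ik≤ik′ (<⇒≱ (<-≤-trans (imagePos-<-suc k′) (imagePos-mono (≰⇒> k≰k′))))

σ-imagePos-fibWord : ∀ m {k} → k ≤ length (fibWord (suc m)) → σ-imagePos (fibWord (suc m)) k ≡ imagePos k
σ-imagePos-fibWord m {zero}  _   = refl
σ-imagePos-fibWord m {suc k} k<n = trans (σ-imagePos-suc (fibWord (suc m)) k<n)
  (cong₂ _+_ (σ-imagePos-fibWord m (<⇒≤ k<n)) (cong ∣σ∣ (at-fibWord m k<n)))

fib∞-σ : ∀ m {p} → p < length (fibWord (suc (suc m))) → fib∞ p ≡ at (σ (fibWord (suc m))) p
fib∞-σ m {p} p<n = trans (sym (at-fibWord (suc m) p<n)) (cong (λ xs → at xs p) (fibWord-σ (suc m)))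

k<length-fibWord-imagePos : ∀ k → k < length (fibWord (suc (imagePos k)))
k<length-fibWord-imagePos k = ≤-<-trans (imagePos-+ zero k) (n<length-fibWord (imagePos k))

-- The images of the first k + 1 letters of fib∞ lie inside its prefix σ (fibWord (suc (imagePos k))).
fib∞-near-imagePos : ∀ k t → t ≤ 1 → let xs = fibWord (suc (imagePos k)) in
  fib∞ (t + imagePos k) ≡ at (σ xs) (t + σ-imagePos xs k)
fib∞-near-imagePos k t t≤1 = begin
  fib∞ (t + m)                ≡⟨ fib∞-σ m (≤-<-trans (+-monoˡ-≤ m t≤1) (n<length-fibWord (suc m))) ⟩
  at (σ xs) (t + m)           ≡⟨ cong (λ p → at (σ xs) (t + p)) (σ-imagePos-fibWord m (<⇒≤ k<n)) ⟨
  at (σ xs) (t + σ-imagePos xs k) ∎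
  where
  open ≡-Reasoning
  m : ℕ
  m = imagePos k
  xs : List Bool
  xs = fibWord (suc m)
  k<n : k < length xs
  k<n = k<length-fibWord-imagePos k

fib∞-imagePos : ∀ k → fib∞ (imagePos k) ≡ true
fib∞-imagePos k = trans (fib∞-near-imagePos k 0 z≤n)
  (at-σ-imagePos (fibWord (suc (imagePos k))) (k<length-fibWord-imagePos k))

fib∞-suc-imagePos-true : ∀ k → fib∞ k ≡ true → fib∞ (suc (imagePos k)) ≡ false
fib∞-suc-imagePos-true k wk = trans (fib∞-near-imagePos k 1 ≤-refl)
  (at-σ-imagePos-true (fibWord (suc (imagePos k))) k<n (trans (at-fibWord (imagePos k) k<n) wk))
  where
  k<n : k < length (fibWord (suc (imagePos k)))
  k<n = k<length-fibWord-imagePos k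

fib∞-suc-imagePos : ∀ k → fib∞ (suc (imagePos k)) ≡ not (fib∞ k)
fib∞-suc-imagePos k with fib∞ k in wk
... | true  = fib∞-suc-imagePos-true k wk
... | false = trans (cong fib∞ (sym (imagePos-suc-false k wk))) (fib∞-imagePos (suc k))

imagePos-cases : ∀ p → ∃ λ k → p ≡ imagePos k ⊎ (p ≡ suc (imagePos k) × fib∞ k ≡ true)
imagePos-cases zero = 0 , inj₁ refl
imagePos-cases (suc p) with imagePos-cases p
... | k , inj₂ (refl , wk) = suc k , inj₁ (sym (imagePos-suc-true k wk))
... | k , inj₁ refl with fib∞ k in wk
...   | true  = k , inj₂ (refl , wk)
...   | false = suc k , inj₁ (sym (imagePos-suc-false k wk))

true-imagePos : ∀ p → fib∞ p ≡ true → ∃ λ k → p ≡ imagePos k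
true-imagePos p wp with imagePos-cases p
... | k , inj₁ p≡ = k , p≡
... | k , inj₂ (refl , wk) = contradiction (trans (sym wp) (fib∞-suc-imagePos-true k wk)) λ ()

false-suc-imagePos : ∀ p → fib∞ p ≡ false → ∃ λ k → p ≡ suc (imagePos k) × fib∞ k ≡ true
false-suc-imagePos p wp with imagePos-cases p
... | k , inj₁ refl = contradiction (trans (sym (fib∞-imagePos k)) wp) λ ()
... | k , inj₂ p≡   = k , p≡

record Agree (n i j : ℕ) : Set where
  constructor agree
  field
    agree-at : ∀ {t} → t < n → fib∞ (i + t) ≡ fib∞ (j + t)
open Agree

Agree-head : ∀ {n i j} → Agree (suc n) i j → fib∞ i ≡ fib∞ j
Agree-head {i = i} {j} ag =
  trans (cong fib∞ (sym (+-identityʳ i))) (trans (agree-at ag (s≤s z≤n)) (cong fib∞ (+-identityʳ j)))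

Agree-sym : ∀ {n i j} → Agree n i j → Agree n j i
Agree-sym ag = agree (λ t<n → sym (agree-at ag t<n))

Agree-trans : ∀ {n i j k} → Agree n i j → Agree n j k → Agree n i k
Agree-trans ag ag′ = agree (λ t<n → trans (agree-at ag t<n) (agree-at ag′ t<n))

Agree-≤ : ∀ {m n i j} → m ≤ n → Agree n i j → Agree m i j
Agree-≤ m≤n ag = agree (λ t<m → agree-at ag (<-≤-trans t<m m≤n))

Agree-snoc : ∀ {n i j} → Agree n i j → fib∞ (i + n) ≡ fib∞ (j + n) → Agree (suc n) i j
Agree-snoc {n} ag eq = agree λ {t} t<1+n → case m≤n⇒m<n∨m≡n (≤-pred t<1+n) of λ where
  (inj₁ t<n)  → agree-at ag t<n
  (inj₂ refl) → eq

Agree-cons : ∀ {n i j} → fib∞ i ≡ fib∞ j → Agree n (suc i) (suc j) → Agree (suc n) i j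
Agree-cons {n} {i} {j} eq ag = agree λ {t} → cons-at t
  where
  cons-at : ∀ t → t < suc n → fib∞ (i + t) ≡ fib∞ (j + t)
  cons-at zero    _         =
    trans (cong fib∞ (+-identityʳ i)) (trans eq (cong fib∞ (sym (+-identityʳ j))))
  cons-at (suc t) (s≤s t<n) =
    trans (cong fib∞ (+-suc i t)) (trans (agree-at ag t<n) (cong fib∞ (sym (+-suc j t))))

Agree-tail : ∀ {n i j} → Agree (suc n) i j → Agree n (suc i) (suc j)
Agree-tail {i = i} {j} ag = agree λ {t} t<n →
  trans (cong fib∞ (sym (+-suc i t))) (trans (agree-at ag (s≤s t<n)) (cong fib∞ (+-suc j t)))

Agree-drop : ∀ k {n i j} → Agree (k + n) i j → Agree n (i + k) (j + k)
Agree-drop k {i = i} {j} ag = agree λ {t} t<n →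
  trans (cong fib∞ (+-assoc i k t)) (trans (agree-at ag (+-monoʳ-< k t<n)) (cong fib∞ (sym (+-assoc j k t))))

-- σ maps the factor of length N at i onto the factor of length D at imagePos i.
record ImageSpan (i N D : ℕ) : Set where
  constructor imageSpan
  field
    image-end : imagePos (i + N) ≡ imagePos i + D
open ImageSpan

ImageSpan-≤ : ∀ {i N D} → ImageSpan i N D → N ≤ D
ImageSpan-≤ {i} {N} {D} (imageSpan eq) =
  +-cancelˡ-≤ (imagePos i) N D (subst (imagePos i + N ≤_) eq (imagePos-+ i N))

ImageSpan-zero : ∀ {i D} → ImageSpan i 0 D → D ≡ 0
ImageSpan-zero {i} {D} (imageSpan eq) = +-cancelˡ-≡ (imagePos i) D 0
  (trans (sym eq) (trans (cong imagePos (+-identityʳ i)) (sym (+-identityʳ (imagePos i)))))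

ImageSpan-∣σ∣ : ∀ {i N D} → ImageSpan i (suc N) D → ∣σ∣ (fib∞ i) ≤ D
ImageSpan-∣σ∣ {i} {N} {D} (imageSpan eq) = +-cancelˡ-≤ (imagePos i) _ D (begin
  imagePos (suc i)      ≤⟨ imagePos-mono (m≤m+n (suc i) N) ⟩
  imagePos (suc i + N)  ≡⟨ cong imagePos (+-suc i N) ⟨
  imagePos (i + suc N)  ≡⟨ eq ⟩
  imagePos i + D        ∎)
  where open ≤-Reasoning

ImageSpan-tail : ∀ {i N D} → ImageSpan i (suc N) D →
  ∃ λ D′ → D ≡ ∣σ∣ (fib∞ i) + D′ × ImageSpan (suc i) N D′
ImageSpan-tail {i} {N} {D} span@(imageSpan eq) = D ∸ β , sym (m+[n∸m]≡n β≤D) , imageSpan (begin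
  imagePos (suc i + N)        ≡⟨ cong imagePos (+-suc i N) ⟨
  imagePos (i + suc N)        ≡⟨ eq ⟩
  imagePos i + D              ≡⟨ cong (imagePos i +_) (m+[n∸m]≡n β≤D) ⟨
  imagePos i + (β + (D ∸ β))  ≡⟨ +-assoc (imagePos i) β (D ∸ β) ⟨
  imagePos (suc i) + (D ∸ β)  ∎)
  where
  open ≡-Reasoning
  β : ℕ
  β = ∣σ∣ (fib∞ i)
  β≤D : β ≤ D
  β≤D = ImageSpan-∣σ∣ span

-- σ true = true false, while σ false is followed by the next image, which begins with true:
-- the second letter of an image determines its preimage.
Agree-imagePos-head : ∀ {i j D} → 2 ≤ D → Agree D (imagePos i) (imagePos j) → fib∞ i ≡ fib∞ j
Agree-imagePos-head {i} {j} 2≤D ag = not-injective (begin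
  not (fib∞ i)              ≡⟨ fib∞-suc-imagePos i ⟨
  fib∞ (suc (imagePos i))   ≡⟨ cong fib∞ (+-comm 1 (imagePos i)) ⟩
  fib∞ (imagePos i + 1)     ≡⟨ agree-at ag 2≤D ⟩
  fib∞ (imagePos j + 1)     ≡⟨ cong fib∞ (+-comm (imagePos j) 1) ⟩
  fib∞ (suc (imagePos j))   ≡⟨ fib∞-suc-imagePos j ⟩
  not (fib∞ j)              ∎)
  where open ≡-Reasoning

desubstitute-head : ∀ {i j N N′ D} → ImageSpan i (suc N) D → ImageSpan j (suc N′) D →
  Agree D (imagePos i) (imagePos j) → fib∞ i ≡ fib∞ j
desubstitute-head {i} {j} si sj ag with fib∞ i in wi | fib∞ j in wj
... | true  | true  = refl
... | false | false = refl
... | true  | false =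
  trans (sym wi) (trans (Agree-imagePos-head {i} {j} (subst (λ x → ∣σ∣ x ≤ _) wi (ImageSpan-∣σ∣ si)) ag) wj)
... | false | true  =
  trans (sym wi) (trans (Agree-imagePos-head {i} {j} (subst (λ x → ∣σ∣ x ≤ _) wj (ImageSpan-∣σ∣ sj)) ag) wj)

desubstitute : ∀ {N N′ i j D} → ImageSpan i N D → ImageSpan j N′ D →
  Agree D (imagePos i) (imagePos j) → N ≡ N′ × Agree N i j
desubstitute {zero}  {zero}   _  _  _ = refl , agree λ ()
desubstitute {zero}  {suc N′} si sj _ =
  contradiction (subst (suc N′ ≤_) (ImageSpan-zero si) (ImageSpan-≤ sj)) λ ()
desubstitute {suc N} {zero}   si sj _ =
  contradiction (subst (suc N ≤_) (ImageSpan-zero sj) (ImageSpan-≤ si)) λ ()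
desubstitute {suc N} {suc N′} {i} {j} si sj ag
  with D′ , D≡ , si′ ← ImageSpan-tail si | D″ , D≡′ , sj′ ← ImageSpan-tail sj =
  Product.map (cong suc) (Agree-cons head) (desubstitute si′ (subst (ImageSpan (suc j) N′) D″≡D′ sj′) tail)
  where
  head : fib∞ i ≡ fib∞ j
  head = desubstitute-head si sj ag
  D″≡D′ : D″ ≡ D′
  D″≡D′ =
    +-cancelˡ-≡ (∣σ∣ (fib∞ i)) D″ D′ (trans (cong (λ x → ∣σ∣ x + D″) head) (trans (sym D≡′) D≡))
  tail : Agree D′ (imagePos (suc i)) (imagePos (suc j))
  tail = subst (λ x → Agree D′ (imagePos (suc i)) (imagePos j + ∣σ∣ x)) head
    (Agree-drop (∣σ∣ (fib∞ i)) (subst (λ D → Agree D (imagePos i) (imagePos j)) D≡ ag))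

true-true-imagePos : ∀ x → fib∞ x ≡ true → fib∞ (suc x) ≡ true →
  ∃ λ h → x ≡ imagePos h × fib∞ h ≡ false
true-true-imagePos x wx wx1 with h , refl ← true-imagePos x wx =
  h , refl , not-injective (trans (sym (fib∞-suc-imagePos h)) wx1)

fib∞-false-suc : ∀ q → fib∞ q ≡ false → fib∞ (suc q) ≡ true
fib∞-false-suc q wq with k , refl , wk ← false-suc-imagePos q wq =
  trans (cong fib∞ (sym (imagePos-suc-true k wk))) (fib∞-imagePos (suc k))

ImageSpan-between : ∀ {i i′ D} → imagePos i + D ≡ imagePos i′ →
  ∃ λ N → i′ ≡ i + N × ImageSpan i N D
ImageSpan-between {i} {i′} {D} eq = i′ ∸ i , sym (m+[n∸m]≡n i≤i′) ,
  imageSpan (trans (cong imagePos (m+[n∸m]≡n i≤i′)) (sym eq))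
  where
  i≤i′ : i ≤ i′
  i≤i′ = imagePos-cancel-≤ (subst (imagePos i ≤_) eq (m≤m+n (imagePos i) D))

desubstitute-pair : ∀ {L h k h′ k′} →
  imagePos (suc h) + L ≡ imagePos h′ → fib∞ h′ ≡ false →
  imagePos (suc k) + L ≡ imagePos k′ → fib∞ k′ ≡ true →
  Agree L (imagePos (suc h)) (imagePos (suc k)) →
  ∃ λ N → N ≤ L × fib∞ (suc k + N) ≡ true × fib∞ (suc h + N) ≡ false × Agree N (suc k) (suc h)
desubstitute-pair {h = h} {k} {h′} {k′} eh wh′ ek wk′ ag
  with N , refl , sh ← ImageSpan-between {suc h} {h′} eh
     | N′ , refl , sk ← ImageSpan-between {suc k} {k′} ek
  with refl , agN ← desubstitute sh sk ag
  = N , ImageSpan-≤ sh , wk′ , wh′ , Agree-sym agN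

BalancedAt : ℕ → Set
BalancedAt L = ∀ p q → fib∞ p ≡ true → fib∞ q ≡ false →
  fib∞ (suc p + L) ≡ true → fib∞ (suc q + L) ≡ false → ¬ Agree L (suc p) (suc q)

-- An occurrence of true u true and one of false u false desubstitute to occurrences of
-- false u′ false and true u′ true with u′ shorter than u.
balanced-step : ∀ L → (∀ {L′} → L′ < L → BalancedAt L′) → BalancedAt L
balanced-step zero    _ _ q _ wq _ wq1 _ =
  contradiction (trans (sym (fib∞-false-suc q wq)) (trans (cong fib∞ (sym (+-identityʳ (suc q)))) wq1)) λ ()
balanced-step (suc L) rec p q wp wq wpL wqL ag
  with k , refl , wk ← false-suc-imagePos q wq
  with h , refl , wh ← true-true-imagePos p wp (trans (Agree-head ag) (fib∞-false-suc q wq))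
  with k′ , qL≡ , wk′ ← false-suc-imagePos (suc (suc q + L))
         (subst (λ x → fib∞ x ≡ false) (+-suc (suc q) L) wqL)
  with h′ , pL≡ , wh′ ← true-true-imagePos (suc p + L)
         (trans (agree-at ag (n<1+n L)) (trans (cong fib∞ (suc-injective qL≡)) (fib∞-imagePos k′)))
         (subst (λ x → fib∞ x ≡ true) (+-suc (suc p) L) wpL)
  with N , N≤L , wkN , whN , agN ← desubstitute-pair {h′ = h′} {k′}
         (subst (λ x → x + L ≡ imagePos h′) (sym (imagePos-suc-false h wh)) pL≡) wh′
         (subst (λ x → x + L ≡ imagePos k′) (sym (imagePos-suc-true k wk)) (suc-injective qL≡)) wk′
         (subst₂ (Agree L) (sym (imagePos-suc-false h wh)) (sym (imagePos-suc-true k wk)) (Agree-≤ (n≤1+n L) ag))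
  = rec (s≤s N≤L) k h wk wh wkN whN agN

balanced-oriented : ∀ L → BalancedAt L
balanced-oriented = <-rec BalancedAt balanced-step

balanced : ∀ L p q → Agree L (suc p) (suc q) →
  fib∞ p ≡ fib∞ (suc p + L) → fib∞ q ≡ fib∞ (suc q + L) → fib∞ p ≡ fib∞ q
balanced L p q ag ep eq with fib∞ p in wp | fib∞ q in wq
... | true  | true  = refl
... | false | false = refl
... | true  | false = ⊥-elim (balanced-oriented L p q wp wq (sym ep) (sym eq) ag)
... | false | true  = ⊥-elim (balanced-oriented L q p wq wp (sym eq) (sym ep) (Agree-sym ag))

RightSpecial : ℕ → ℕ → ℕ → Set
RightSpecial n i j = Agree n i j × fib∞ (i + n) ≢ fib∞ (j + n)

RightSpecial-drop : ∀ k {n i j} → RightSpecial (k + n) i j → RightSpecial n (i + k) (j + k)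
RightSpecial-drop k {n} {i} {j} (ag , ne) =
  Agree-drop k ag , λ eq → ne (trans (cong fib∞ (sym (+-assoc i k n))) (trans eq (cong fib∞ (+-assoc j k n))))

near-commute : ∀ m → ∃ λ t → ∃₂ λ x y → x ≢ y ×
  fibWord (suc m) ++ fibWord m ≡ t ++ x ∷ y ∷ [] × fibWord m ++ fibWord (suc m) ≡ t ++ y ∷ x ∷ []
near-commute zero    = [] , true , false , (λ ()) , refl , refl
near-commute (suc m) with t , x , y , x≢y , e₁ , e₂ ← near-commute m =
  fibWord (suc m) ++ t , y , x , (λ y≡x → x≢y (sym y≡x)) ,
  trans (++-assoc (fibWord (suc m)) (fibWord m) (fibWord (suc m)))
    (trans (cong (fibWord (suc m) ++_) e₂) (sym (++-assoc (fibWord (suc m)) t _))) ,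
  trans (cong (fibWord (suc m) ++_) e₁) (sym (++-assoc (fibWord (suc m)) t _))

fib∞-factor : ∀ M xs ys zs → fibWord (suc M) ≡ xs ++ ys ++ zs →
  ∀ {i} → i < length ys → fib∞ (length xs + i) ≡ at ys i
fib∞-factor M xs ys zs eq {i} i< = begin
  fib∞ (length xs + i)                  ≡⟨ at-fibWord M bound ⟨
  at (fibWord (suc M)) (length xs + i)  ≡⟨ cong (λ ws → at ws (length xs + i)) eq ⟩
  at (xs ++ ys ++ zs) (length xs + i)   ≡⟨ at-++ʳ xs (ys ++ zs) i ⟩
  at (ys ++ zs) i                       ≡⟨ at-++ˡ ys zs i< ⟩
  at ys i                               ∎
  where
  open ≡-Reasoning
  bound : length xs + i < length (fibWord (suc M))
  bound = subst (length xs + i <_) (sym (trans (cong length eq) (length-++ xs)))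
    (+-monoʳ-< (length xs) (<-≤-trans i< (subst (length ys ≤_) (sym (length-++ ys)) (m≤m+n _ _))))

at-++-length : ∀ t x ys → at (t ++ x ∷ ys) (length t) ≡ x
at-++-length []      x ys = refl
at-++-length (_ ∷ t) x ys = at-++-length t x ys

-- Inside fibWord (n + 3) = (fibWord (n + 1) ++ fibWord n) ++ fibWord (n + 1)
--                      = fibWord (n + 1) ++ (fibWord n ++ fibWord (n + 1)),
-- the word t occurs at 0 followed by x and at length (fibWord (n + 1)) followed by y.
RightSpecial-near-commute : ∀ n {t x y} → x ≢ y →
  fibWord (suc n) ++ fibWord n ≡ t ++ x ∷ y ∷ [] → fibWord n ++ fibWord (suc n) ≡ t ++ y ∷ x ∷ [] →
  RightSpecial (length t) 0 (length (fibWord (suc n)))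
RightSpecial-near-commute n {t} {x} {y} x≢y e₁ e₂ =
  agree (λ {i} i<t → trans (left (<⇒≤ i<t)) (trans (at-++ˡ t _ i<t)
                       (trans (sym (at-++ˡ t _ i<t)) (sym (right (<⇒≤ i<t)))))) ,
  λ eq → x≢y (trans (sym (trans (left ≤-refl) (at-++-length t x _)))
               (trans eq (trans (right ≤-refl) (at-++-length t y _))))
  where
  within : ∀ {i} u v → i ≤ length t → i < length (t ++ u ∷ v ∷ [])
  within {i} u v i≤t = subst (i <_) (sym (length-++ t)) (≤-<-trans i≤t (m<m+n (length t) (s≤s z≤n)))
  fibWord≡ : fibWord (suc (suc (suc n))) ≡ fibWord (suc n) ++ (t ++ y ∷ x ∷ []) ++ []
  fibWord≡ = begin
    (fibWord (suc n) ++ fibWord n) ++ fibWord (suc n)   ≡⟨ ++-assoc (fibWord (suc n)) (fibWord n) _ ⟩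
    fibWord (suc n) ++ fibWord n ++ fibWord (suc n)     ≡⟨ cong (fibWord (suc n) ++_) e₂ ⟩
    fibWord (suc n) ++ t ++ y ∷ x ∷ []                  ≡⟨ cong (fibWord (suc n) ++_) (++-identityʳ _) ⟨
    fibWord (suc n) ++ (t ++ y ∷ x ∷ []) ++ []           ∎
    where open ≡-Reasoning
  left : ∀ {i} → i ≤ length t → fib∞ i ≡ at (t ++ x ∷ y ∷ []) i
  left i≤t = fib∞-factor (suc (suc n)) [] (t ++ x ∷ y ∷ []) (fibWord (suc n)) (cong (_++ fibWord (suc n)) e₁)
    (within x y i≤t)
  right : ∀ {i} → i ≤ length t → fib∞ (length (fibWord (suc n)) + i) ≡ at (t ++ y ∷ x ∷ []) i
  right i≤t = fib∞-factor (suc (suc n)) (fibWord (suc n)) (t ++ y ∷ x ∷ []) [] fibWord≡ (within y x i≤t)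

rightSpecial-exists : ∀ n → ∃₂ (RightSpecial n)
rightSpecial-exists n with t , x , y , x≢y , e₁ , e₂ ← near-commute n =
  _ , _ , RightSpecial-drop (length t ∸ n)
    (subst (λ T → RightSpecial T 0 _) (sym (m∸n+n≡m (n≤length-t e₁)))
      (RightSpecial-near-commute n x≢y e₁ e₂))
  where
  n≤length-t : ∀ {t x y} → fibWord (suc n) ++ fibWord n ≡ t ++ x ∷ y ∷ [] → n ≤ length t
  n≤length-t {t} e₁ = +-cancelʳ-≤ 2 n (length t) (begin
    n + 2                                       ≡⟨ +-comm n 2 ⟩
    suc (suc n)                                 ≤⟨ n<length-fibWord (suc n) ⟩
    length (fibWord (suc n) ++ fibWord n)       ≡⟨ cong length e₁ ⟩
    length (t ++ _ ∷ _ ∷ [])                    ≡⟨ length-++ t ⟩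
    length t + 2                                ∎)
    where open ≤-Reasoning

Agree-refl : ∀ {n i} → Agree n i i
Agree-refl = agree λ _ → refl

RightSpecial-tail : ∀ {n i j} → RightSpecial (suc n) i j → RightSpecial n (suc i) (suc j)
RightSpecial-tail {n} {i} {j} (ag , ne) =
  Agree-tail ag , λ eq → ne (trans (cong fib∞ (+-suc i n)) (trans eq (cong fib∞ (sym (+-suc j n)))))

RightSpecial-extension : ∀ {n i j} → RightSpecial n i j → ∀ x →
  ∃ λ r → Agree n r i × fib∞ (r + n) ≡ x
RightSpecial-extension {n} {i} {j} (ag , ne) x with fib∞ (i + n) ≟ᵇ x
... | yes eq = i , Agree-refl , eq
... | no  ne′ = j , Agree-sym ag , trans (¬-not (λ eq → ne (sym eq))) (sym (¬-not (λ eq → ne′ (sym eq))))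

-- Extending x u by x and y u by y yields x u x and y u y, so balance forces x = y.
rightSpecial-head : ∀ {n i j i′ j′} → RightSpecial (suc n) i j → RightSpecial (suc n) i′ j′ →
  Agree n (suc i) (suc i′) → fib∞ i ≡ fib∞ i′
rightSpecial-head {n} {i} {i′ = i′} rs rs′ tails
  with r , agr , er ← RightSpecial-extension rs (fib∞ i)
     | r′ , agr′ , er′ ← RightSpecial-extension rs′ (fib∞ i′) =
  trans (sym (Agree-head agr)) (trans same (Agree-head agr′))
  where
  same : fib∞ r ≡ fib∞ r′
  same = balanced n r r′ (Agree-trans (Agree-tail agr) (Agree-trans tails (Agree-sym (Agree-tail agr′))))
    (trans (Agree-head agr) (trans (sym er) (cong fib∞ (+-suc r n))))
    (trans (Agree-head agr′) (trans (sym er′) (cong fib∞ (+-suc r′ n))))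

rightSpecial-unique : ∀ n {i j i′ j′} → RightSpecial n i j → RightSpecial n i′ j′ → Agree n i i′
rightSpecial-unique zero    _  _   = agree λ ()
rightSpecial-unique (suc n) {i} {i′ = i′} rs rs′ = Agree-cons (rightSpecial-head rs rs′ tails) tails
  where
  tails : Agree n (suc i) (suc i′)
  tails = rightSpecial-unique n (RightSpecial-tail rs) (RightSpecial-tail rs′)

AllPairs-¬-≡ : ∀ {A : Set} {S : A → A → Set} {xs x y} → (∀ {u v} → S u v → S v u) →
  AllPairs (λ u v → ¬ S u v) xs → x ∈ xs → y ∈ xs → S x y → x ≡ y
AllPairs-¬-≡ sym-S (_  ∷ _)  (here refl) (here refl) _   = refl
AllPairs-¬-≡ sym-S (¬S ∷ _)  (here refl) (there y∈)  Sxy = contradiction Sxy (All.lookup ¬S y∈)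
AllPairs-¬-≡ sym-S (¬S ∷ _)  (there x∈)  (here refl) Sxy = contradiction (sym-S Sxy) (All.lookup ¬S x∈)
AllPairs-¬-≡ sym-S (_  ∷ ps) (there x∈)  (there y∈)  Sxy = AllPairs-¬-≡ sym-S ps x∈ y∈ Sxy

record Representatives (n : ℕ) : Set where
  field
    positions        : List ℕ
    length-positions : length positions ≡ suc n
    distinct         : AllPairs (λ p p′ → ¬ Agree n p p′) positions
    complete         : ∀ i → ∃ λ p → p ∈ positions × Agree n i p

representatives-zero : Representatives 0
representatives-zero = record
  { positions        = 0 ∷ []
  ; length-positions = refl
  ; distinct         = [] ∷ []
  ; complete         = λ _ → 0 , here refl , agree λ ()
  }

-- Each factor of length n has one extension, except the right special one, which has two:
-- its second extension is represented by a new position q.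
representatives-suc : ∀ {n} → Representatives n → Representatives (suc n)
representatives-suc {n} reps
  with z , z′ , rs ← rightSpecial-exists n
  with p₀ , p₀∈ , z≈p₀ ← Representatives.complete reps z
  with q , q≈z , wq ← RightSpecial-extension rs (not (fib∞ (p₀ + n))) = record
  { positions        = positions ++ q ∷ []
  ; length-positions = trans (length-++ positions) (trans (cong (_+ 1) length-positions) (+-comm (suc n) 1))
  ; distinct         = AllPairs.++⁺ (AllPairs.map (λ ¬ag ag → ¬ag (Agree-≤ (n≤1+n n) ag)) distinct)
                         ([] ∷ []) (All.tabulate λ p∈ → new-distinct p∈ ∷ [])
  ; complete         = complete′
  }
  where
  open Representatives reps
  q≈p₀ : Agree n q p₀
  q≈p₀ = Agree-trans q≈z z≈p₀
  q≢p₀ : fib∞ (q + n) ≢ fib∞ (p₀ + n)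
  q≢p₀ eq = not-¬ refl (trans (sym eq) wq)
  is-p₀ : ∀ {p} → p ∈ positions → Agree n p p₀ → p ≡ p₀
  is-p₀ p∈ = AllPairs-¬-≡ Agree-sym distinct p∈ p₀∈
  new-distinct : ∀ {p} → p ∈ positions → ¬ Agree (suc n) p q
  new-distinct p∈ ag with refl ← is-p₀ p∈ (Agree-trans (Agree-≤ (n≤1+n n) ag) q≈p₀) =
    q≢p₀ (sym (agree-at ag ≤-refl))
  complete′ : ∀ i → ∃ λ p → p ∈ positions ++ q ∷ [] × Agree (suc n) i p
  complete′ i with p , p∈ , i≈p ← complete i with fib∞ (i + n) ≟ᵇ fib∞ (p + n)
  ... | yes eq = p , ∈-++⁺ˡ p∈ , Agree-snoc i≈p eq
  ... | no  ne
    with refl ← is-p₀ p∈ (Agree-trans (Agree-sym i≈p) (Agree-trans (rightSpecial-unique n (i≈p , ne) rs) z≈p₀)) =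
    q , ∈-++⁺ʳ positions (here refl) ,
    Agree-snoc (Agree-trans i≈p (Agree-sym q≈p₀)) (trans (¬-not ne) (sym wq))

representatives : ∀ n → Representatives n
representatives zero    = representatives-zero
representatives (suc n) = representatives-suc (representatives n)

factor : ℕ → (n : ℕ) → Vec Bool n
factor i n = tabulate λ t → fib∞ (i + toℕ t)

factor-≡⇒Agree : ∀ {n i j} → factor i n ≡ factor j n → Agree n i j
factor-≡⇒Agree {n} {i} {j} eq = agree λ {t} t<n → begin
  fib∞ (i + t)                          ≡⟨ cong (λ s → fib∞ (i + s)) (toℕ-fromℕ< t<n) ⟨
  fib∞ (i + toℕ (fromℕ< t<n))           ≡⟨ lookup∘tabulate _ (fromℕ< t<n) ⟨
  lookup (factor i n) (fromℕ< t<n)      ≡⟨ cong (λ v → lookup v (fromℕ< t<n)) eq ⟩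
  lookup (factor j n) (fromℕ< t<n)      ≡⟨ lookup∘tabulate _ (fromℕ< t<n) ⟩
  fib∞ (j + toℕ (fromℕ< t<n))           ≡⟨ cong (λ s → fib∞ (j + s)) (toℕ-fromℕ< t<n) ⟩
  fib∞ (j + t)                          ∎
  where open ≡-Reasoning

Agree⇒factor-≡ : ∀ {n i j} → Agree n i j → factor i n ≡ factor j n
Agree⇒factor-≡ ag = tabulate-cong λ t → agree-at ag (toℕ<n t)

record Enumeration {B : Set} (f : ℕ → B) (N : ℕ) : Set where
  field
    elements        : List B
    length-elements : length elements ≡ N
    unique          : Unique elements
    complete        : ∀ i → f i ∈ elements
    sound           : All (λ y → ∃ λ i → f i ≡ y) elements

factor-enumeration : ∀ n → Enumeration (λ i → factor i n) (n + 1)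
factor-enumeration n = record
  { elements        = map (λ p → factor p n) positions
  ; length-elements = trans (length-map _ positions) (trans length-positions (+-comm 1 n))
  ; unique          = AllPairs.map⁺ (AllPairs.map (λ ¬ag eq → ¬ag (factor-≡⇒Agree eq)) distinct)
  ; complete        = λ i → let p , p∈ , i≈p = complete i in
                        subst (_∈ _) (sym (Agree⇒factor-≡ i≈p)) (∈-map⁺ (λ p → factor p n) p∈)
  ; sound           = All.map⁺ (All.tabulate λ {p} _ → p , refl)
  }
  where open Representatives (representatives n)

length-cartesianProductWith : ∀ {A B C : Set} (h : A → B → C) xs ys →
  length (cartesianProductWith h xs ys) ≡ length xs * length ys
length-cartesianProductWith h []       ys = refl
length-cartesianProductWith h (x ∷ xs) ys =
  trans (length-++ (map (h x) ys)) (cong₂ _+_ (length-map (h x) ys) (length-cartesianProductWith h xs ys))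

Enumeration-product : ∀ {A B C : Set} {f : ℕ → A} {g : ℕ → B} {N M}
  (F : ℕ → ℕ → C) (h : A → B → C) → (∀ i j → F i j ≡ h (f i) (g j)) →
  (∀ {x x′ y y′} → h x y ≡ h x′ y′ → x ≡ x′ × y ≡ y′) →
  Enumeration f N → Enumeration g M →
  Σ (List C) λ L → (length L ≡ N * M) × Unique L
    × (∀ i j → F i j ∈ L) × All (λ z → ∃ λ i → ∃ λ j → F i j ≡ z) L
Enumeration-product {A} {B} {f = f} {g} F h F≡ h-injective enumF enumG =
  cartesianProductWith h xs ys ,
  trans (length-cartesianProductWith h xs ys) (cong₂ _*_ (length-elements enumF) (length-elements enumG)) ,
  cartesianProductWith⁺ h h-injective (unique enumF) (unique enumG) ,
  (λ i j → subst (_∈ _) (sym (F≡ i j)) (∈-cartesianProductWith⁺ h (complete enumF i) (complete enumG j))) ,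
  All.tabulate sound-product
  where
  open Enumeration
  xs : List A
  xs = elements enumF
  ys : List B
  ys = elements enumG
  sound-product : ∀ {z} → z ∈ cartesianProductWith h xs ys → ∃ λ i → ∃ λ j → F i j ≡ z
  sound-product z∈ with x , y , x∈ , y∈ , refl ← ∈-cartesianProductWith⁻ h xs ys z∈
                   with i , refl ← All.lookup (sound enumF) x∈ | j , refl ← All.lookup (sound enumG) y∈ =
    i , j , F≡ i j

grid : ∀ {k l} → Vec Bool k → Vec Bool l → Vec (Vec Letter l) k
grid u v = tabulate λ x → tabulate λ y → letter (lookup u x) (lookup v y)

block-grid : ∀ k l i j → block k l i j ≡ grid (factor i k) (factor j l)
block-grid k l i j = tabulate-cong λ x → tabulate-cong λ y → trans (fInf-letter (i + toℕ x) (j + toℕ y))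
  (sym (cong₂ letter (lookup∘tabulate _ x) (lookup∘tabulate _ y)))

lookup-grid : ∀ {k l} (u : Vec Bool k) (v : Vec Bool l) x y →
  lookup (lookup (grid u v) x) y ≡ letter (lookup u x) (lookup v y)
lookup-grid u v x y = trans (cong (λ row → lookup row y) (lookup∘tabulate _ x)) (lookup∘tabulate _ y)

lookup-ext : ∀ {A : Set} {n} {u v : Vec A n} → (∀ x → lookup u x ≡ lookup v x) → u ≡ v
lookup-ext {u = u} {v} eq = trans (sym (tabulate∘lookup u)) (trans (tabulate-cong eq) (tabulate∘lookup v))

grid-injective : ∀ {k l} {u u′ : Vec Bool (suc k)} {v v′ : Vec Bool (suc l)} →
  grid u v ≡ grid u′ v′ → u ≡ u′ × v ≡ v′
grid-injective {u = u} {u′} {v} {v′} eq =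
  lookup-ext (λ x → proj₁ (letter-injective (entries x zero))) ,
  lookup-ext (λ y → proj₂ (letter-injective (entries zero y)))
  where
  entries : ∀ x y → letter (lookup u x) (lookup v y) ≡ letter (lookup u′ x) (lookup v′ y)
  entries x y = trans (sym (lookup-grid u v x y))
    (trans (cong (λ B → lookup (lookup B x) y) eq) (lookup-grid u′ v′ x y))

proposition5 : (k l : ℕ) → k ≥ 1 → l ≥ 1 → ComplexityIs k l ((k + 1) * (l + 1))
proposition5 (suc k) (suc l) _ _ =
  Enumeration-product (block (suc k) (suc l)) grid (block-grid (suc k) (suc l)) grid-injective
    (factor-enumeration (suc k)) (factor-enumeration (suc l))
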